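{- For $4\le n\le 5$, $\kappa(Q_n;K_{1,4})=\kappa^s(Q_n;K_{1,4})=\lceil \frac{n}{2}\rceil$.
   Context: The $n$-dimensional hypercube $Q_n$ has as vertices all binary strings of length $n$, two strings being adjacent iff they differ in exactly one position. $K_{1,r}$ denotes the star with $r$ leaves. For a graph $G$ and a set $F$ of subgraphs of $G$, $G-F$ denotes the graph obtained from $G$ by deleting all vertices of all members of $F$. For a connected graph $T$, $\kappa(G;T)$ is the minimum cardinality of a set $F$ of subgraphs of $G$, each isomorphic to $T$, such that $G-F$ is disconnected; $\kappa^s(G;T)$ is the minimum cardinality of a set $F$ of subgraphs of $G$, each isomorphic to a connected subgraph of $T$, such that $G-F$ is disconnected. -}

module Defs where

open import Data.Nat using (ℕ; _≤_; _<_)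
open import Data.Bool using (Bool)
open import Data.Fin using (Fin)
open import Data.Vec using (Vec; lookup)
open import Data.Vec.Membership.Propositional using () renaming (_∈_ to _∈ᵥ_)
open import Data.List using (List; length)
open import Data.List.Relation.Unary.Any using (Any)
open import Data.Product using (Σ; _×_; ∃)
open import Data.Sum using (_⊎_)
open import Relation.Binary.PropositionalEquality using (_≡_; _≢_)
open import Relation.Nullary using (¬_)

Vertex : ℕ → Set
Vertex n = Vec Bool n

Adj : {n : ℕ} → Vertex n → Vertex n → Set
Adj {n} u v = Σ (Fin n) λ i → (lookup u i ≢ lookup v i) × (∀ j → j ≢ i → lookup u j ≡ lookup v j)

-- A subgraph of Q_n isomorphic to the star K_{1,r}: a center together with
-- r pairwise distinct neighbours of it (the leaves); edges are center–leaf.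
record Star (n r : ℕ) : Set where
  field
    center   : Vertex n
    leaves   : Vec (Vertex n) r
    adjacent : ∀ i → Adj center (lookup leaves i)
    distinct : ∀ i j → lookup leaves i ≡ lookup leaves j → i ≡ j
open Star public

InStar : {n r : ℕ} → Star n r → Vertex n → Set
InStar s v = (v ≡ center s) ⊎ (v ∈ᵥ leaves s)

-- Subgraphs isomorphic to a connected subgraph of K_{1,k}: these are exactly
-- the stars K_{1,r} with 0 ≤ r ≤ k (K_{1,0} = K_1).
SubStar : ℕ → ℕ → Set
SubStar n k = Σ ℕ λ r → (r ≤ k) × Star n r

InSubStar : {n k : ℕ} → SubStar n k → Vertex n → Set
InSubStar (r Data.Product., (_ Data.Product., s)) v = InStar s v

-- Paths inside a vertex set S of Q_n (all vertices after the first lie in S).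
data Reach {n : ℕ} (S : Vertex n → Set) : Vertex n → Vertex n → Set where
  here : ∀ {x} → Reach S x x
  step : ∀ {x y z} → Adj x y → S y → Reach S y z → Reach S x z

-- G - F for a family F (members with vertex-membership predicate `mem`) is
-- disconnected: two surviving vertices not joined by a path of survivors.
Disconnects : {n : ℕ} {A : Set} → (A → Vertex n → Set) → List A → Set
Disconnects {n} mem F =
  let Survives = λ (v : Vertex n) → ¬ Any (λ s → mem s v) F in
  Σ (Vertex n) λ x → Σ (Vertex n) λ y →
    Survives x × Survives y × ¬ Reach Survives x y

IsMinCard : {A : Set} → (List A → Set) → ℕ → Set
IsMinCard {A} P m =
  (Σ (List A) λ F → (length F ≡ m) × P F) × (∀ (F : List A) → length F < m → ¬ P F)

KappaStar : ℕ → ℕ → ℕ → Set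
KappaStar n r m = IsMinCard (Disconnects {n} {Star n r} InStar) m

KappaSStar : ℕ → ℕ → ℕ → Set
KappaSStar n r m = IsMinCard (Disconnects {n} {SubStar n r} InSubStar) m

-- Every K_{1,4} of Q_n, and every star contained in one, lies in the closed
-- neighbourhood N[c] of its centre c, and contains c. So removing fewer than
-- ⌈n/2⌉ such subgraphs removes at most two centres c₁, c₂ and otherwise only
-- vertices of N[c₁] ∪ N[c₂]. For n = 4, 5 one checks exhaustively, over all
-- admissible centres, that the vertices at distance at least 2 from both
-- centres induce a connected subgraph (certified by a root towards which every
-- such vertex has a neighbour one step closer) which dominates every vertex
-- other than c₁, c₂; hence whatever survives stays connected. Conversely
-- ⌈n/2⌉ stars centred at distance 2 from 0…0 cover all n neighbours of 0…0
-- while missing 0…0 and 1…1, which isolates 0…0.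
module Submission where

open import Defs
open import Level using (0ℓ)
open import Data.Nat using (ℕ; zero; suc; _+_; _≤_; _<_; _<?_; z≤n; s≤s; ⌈_/2⌉)
open import Data.Nat.Properties using (<⇒≱; n<1+n; ≤-refl; ≤-reflexive)
open import Data.Nat.Induction using (<-wellFounded)
open import Data.Bool using (true; false; not; _xor_; if_then_else_)
open import Data.Bool.Properties using (not-¬; xor-same; xor-inverseʳ)
  renaming (_≟_ to _≟ᵇ_)
open import Data.Fin using (Fin; zero; suc; inject₁) renaming (_≟_ to _≟ᶠ_)
open import Data.Fin.Properties using (any?; all?; inject₁-injective)
open import Data.Vec using ([]; _∷_; lookup; updateAt; tabulate; replicate)
open import Data.Vec.Properties using (≡-dec; lookup∘updateAt; lookup∘updateAt′; lookup∘tabulate)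
open import Data.Vec.Relation.Binary.Pointwise.Extensional using (ext; Pointwise-≡⇒≡)
open import Data.Vec.Membership.Propositional using () renaming (_∈_ to _∈ᵥ_)
open import Data.Vec.Relation.Unary.Any using (index)
open import Data.Vec.Relation.Unary.Any.Properties using (lookup-index)
open import Data.List using (List; []; _∷_; length; map)
open import Data.List.Properties using (length-map)
open import Data.List.Relation.Unary.Any using (Any; here; there) renaming (any? to anyₗ?)
open import Data.List.Relation.Unary.Any.Properties using (map⁺; map⁻)
open import Data.Product using (_×_; _,_; proj₂; ∃)
open import Data.Sum using (_⊎_; inj₁; inj₂; [_,_])
open import Data.Unit using (⊤; tt)
open import Function using (id; _∘_)
open import Function.Definitions using (Injective)
open import Induction.WellFounded using (Acc; acc)
open import Relation.Binary.PropositionalEquality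
  using (_≡_; _≢_; refl; sym; trans; cong; subst)
open import Relation.Nullary using (Dec; yes; no; ¬_; ¬?; contradiction)
open import Relation.Nullary.Decidable
  using (map′; _×-dec_; _⊎-dec_; _→-dec_; from-yes; from-no)
open import Relation.Unary using (Pred; Decidable; _⊆_)

private
  variable
    n r : ℕ

_≟_ : (u v : Vertex n) → Dec (u ≡ v)
_≟_ = ≡-dec _≟ᵇ_

flip : Fin n → Vertex n → Vertex n
flip i v = updateAt v i not

flip-adjacent : (i : Fin n) (v : Vertex n) → Adj v (flip i v)
flip-adjacent i v =
  i , (λ eq → not-¬ refl (trans eq (lookup∘updateAt i v))) ,
  λ j j≢i → sym (lookup∘updateAt′ j i j≢i v)

adjacent⇒flip : {u v : Vertex n} → Adj u v → ∃ λ i → v ≡ flip i u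
adjacent⇒flip {u = u} {v} (i , differ , agree) = i , Pointwise-≡⇒≡ (ext coordinate)
  where
  not-of-other : ∀ {a b} → a ≢ b → b ≡ not a
  not-of-other {false} {false} a≢b = contradiction refl a≢b
  not-of-other {false} {true}  _   = refl
  not-of-other {true}  {false} _   = refl
  not-of-other {true}  {true}  a≢b = contradiction refl a≢b

  coordinate : ∀ j → lookup v j ≡ lookup (flip i u) j
  coordinate j with j ≟ᶠ i
  ... | yes refl = trans (not-of-other differ) (sym (lookup∘updateAt i u))
  ... | no j≢i   = trans (sym (agree j j≢i)) (sym (lookup∘updateAt′ j i j≢i u))

Adj-sym : {u v : Vertex n} → Adj u v → Adj v u
Adj-sym (i , differ , agree) = i , differ ∘ sym , λ j j≢i → sym (agree j j≢i)

flip-injective : (v : Vertex n) {i j : Fin n} → flip i v ≡ flip j v → i ≡ j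
flip-injective v {i} {j} eq with i ≟ᶠ j
... | yes i≡j = i≡j
... | no i≢j  = contradiction
  (trans (sym (lookup∘updateAt′ i j i≢j v)) (trans (cong (λ w → lookup w i) (sym eq)) (lookup∘updateAt i v)))
  (not-¬ refl)

hamming : Vertex n → Vertex n → ℕ
hamming []      []      = 0
hamming (a ∷ u) (b ∷ v) = (if a xor b then 1 else 0) + hamming u v

hamming-refl : (v : Vertex n) → hamming v v ≡ 0
hamming-refl []      = refl
hamming-refl (a ∷ v) rewrite xor-same a = hamming-refl v

hamming-flip : (i : Fin n) (v : Vertex n) → hamming v (flip i v) ≡ 1
hamming-flip zero    (a ∷ v) rewrite xor-inverseʳ a | hamming-refl v = refl
hamming-flip (suc i) (a ∷ v) rewrite xor-same a = hamming-flip i v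

hamming-adjacent : {u v : Vertex n} → Adj u v → hamming u v ≡ 1
hamming-adjacent {u = u} {v} adj with adjacent⇒flip {u = u} {v} adj
... | i , refl = hamming-flip i u

flip-towards : (u v : Vertex n) → u ≢ v → ∃ λ i → hamming (flip i u) v < hamming u v
flip-towards []          []          u≢v = contradiction refl u≢v
flip-towards (false ∷ u) (true ∷ v)  _   = zero , n<1+n (hamming u v)
flip-towards (true ∷ u)  (false ∷ v) _   = zero , n<1+n (hamming u v)
flip-towards (false ∷ u) (false ∷ v) u≢v =
  let i , closer = flip-towards u v (u≢v ∘ cong (false ∷_)) in suc i , closer
flip-towards (true ∷ u)  (true ∷ v)  u≢v =
  let i , closer = flip-towards u v (u≢v ∘ cong (true ∷_)) in suc i , closer

Reach-trans : {S : Pred (Vertex n) 0ℓ} {x y z : Vertex n} → Reach S x y → Reach S y z → Reach S x z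
Reach-trans here            q = q
Reach-trans (step adj sy p) q = step adj sy (Reach-trans p q)

Reach-reverse : {S : Pred (Vertex n) 0ℓ} {x y : Vertex n} → Reach S x y → S x → Reach S y x
Reach-reverse here _ = here
Reach-reverse {x = x} (step {y = y} adj sy p) sx =
  Reach-trans (Reach-reverse p sy) (step (Adj-sym {u = x} {y} adj) sx here)

Reach-mono : {S T : Pred (Vertex n) 0ℓ} {x y : Vertex n} → S ⊆ T → Reach S x y → Reach T x y
Reach-mono S⊆T here            = here
Reach-mono S⊆T (step adj sy p) = step adj (S⊆T sy) (Reach-mono S⊆T p)

DescentRoot : Pred (Vertex n) 0ℓ → Vertex n → Set
DescentRoot {n} D r =
  ∀ v → D v → v ≡ r ⊎ ∃ λ (i : Fin n) → D (flip i v) × hamming (flip i v) r < hamming v r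

Dominates : Pred (Vertex n) 0ℓ → Pred (Vertex n) 0ℓ → Set
Dominates {n} D S = ∀ v → S v → D v ⊎ ∃ λ (i : Fin n) → D (flip i v)

module _ {S D : Pred (Vertex n) 0ℓ} (D⊆S : D ⊆ S) {r : Vertex n} (root : DescentRoot D r) where

  descend : ∀ {v} → D v → Reach S v r
  descend {v} = go v (<-wellFounded (hamming v r))
    where
    go : ∀ v → Acc _<_ (hamming v r) → D v → Reach S v r
    go v (acc closer) dv with root v dv
    ... | inj₁ refl = here
    ... | inj₂ (i , dw , w<v) = step (flip-adjacent i v) (D⊆S dw) (go (flip i v) (closer w<v) dw)

  dominated-connected : Dominates D S → ∀ {x y} → S x → S y → Reach S x y
  dominated-connected dominates sx sy = Reach-trans (to-root sx) (Reach-reverse (to-root sy) sy)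
    where
    to-root : ∀ {v} → S v → Reach S v r
    to-root {v} sv with dominates v sv
    ... | inj₁ dv       = descend dv
    ... | inj₂ (i , dw) = step (flip-adjacent i v) (D⊆S dw) (descend dw)

hypercube-connected : {S : Pred (Vertex n) 0ℓ} → (∀ v → S v) → ∀ x y → Reach S x y
hypercube-connected all-S x y =
  dominated-connected {D = λ _ → ⊤} (λ _ → all-S _) towards-y (λ _ _ → inj₁ tt) (all-S x) (all-S y)
  where
  towards-y : DescentRoot (λ _ → ⊤) y
  towards-y v _ with v ≟ y
  ... | yes v≡y = inj₁ v≡y
  ... | no v≢y  = let i , closer = flip-towards v y v≢y in inj₂ (i , tt , closer)

all-vertices? : {P : Pred (Vertex n) 0ℓ} → Decidable P → Dec (∀ v → P v)
all-vertices? {zero}  P? = map′ (λ { p [] → p }) (λ p → p []) (P? [])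
all-vertices? {suc n} P? =
  map′ (λ { (p₀ , p₁) (false ∷ v) → p₀ v ; (p₀ , p₁) (true ∷ v) → p₁ v })
       (λ p → (λ v → p (false ∷ v)) , (λ v → p (true ∷ v)))
       (all-vertices? (P? ∘ (false ∷_)) ×-dec all-vertices? (P? ∘ (true ∷_)))

any-vertex? : {P : Pred (Vertex n) 0ℓ} → Decidable P → Dec (∃ P)
any-vertex? {zero}  P? = map′ ([] ,_) (λ { ([] , p) → p }) (P? [])
any-vertex? {suc n} P? =
  map′ [ (λ (v , p) → false ∷ v , p) , (λ (v , p) → true ∷ v , p) ]
       (λ { (false ∷ v , p) → inj₁ (v , p) ; (true ∷ v , p) → inj₂ (v , p) })
       (any-vertex? (P? ∘ (false ∷_)) ⊎-dec any-vertex? (P? ∘ (true ∷_)))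

descentRoot? : {D : Pred (Vertex n) 0ℓ} → Decidable D → Decidable (DescentRoot D)
descentRoot? D? r = all-vertices? λ v → D? v →-dec
  (v ≟ r ⊎-dec any? λ i → D? (flip i v) ×-dec hamming (flip i v) r <? hamming v r)

dominates? : {D S : Pred (Vertex n) 0ℓ} → Decidable D → Decidable S → Dec (Dominates D S)
dominates? D? S? = all-vertices? λ v → S? v →-dec (D? v ⊎-dec any? λ i → D? (flip i v))

Far : Vertex n → Vertex n → Pred (Vertex n) 0ℓ
Far c₁ c₂ v = 1 < hamming c₁ v × 1 < hamming c₂ v

FarIsConnectedDominating : Vertex n → Vertex n → Set
FarIsConnectedDominating c₁ c₂ =
  ∃ (DescentRoot (Far c₁ c₂)) × Dominates (Far c₁ c₂) (λ v → v ≢ c₁ × v ≢ c₂)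

farIsConnectedDominating? : (c₁ c₂ : Vertex n) → Dec (FarIsConnectedDominating c₁ c₂)
farIsConnectedDominating? c₁ c₂ =
  any-vertex? (descentRoot? far?) ×-dec dominates? far? (λ v → ¬? (v ≟ c₁) ×-dec ¬? (v ≟ c₂))
  where
  far? : Decidable (Far c₁ c₂)
  far? v = 1 <? hamming c₁ v ×-dec 1 <? hamming c₂ v

Q₄-single-centre : (c : Vertex 4) → FarIsConnectedDominating c c
Q₄-single-centre = from-yes (all-vertices? {4} λ c → farIsConnectedDominating? c c)

Q₅-two-centres : (c₁ c₂ : Vertex 5) → FarIsConnectedDominating c₁ c₂
Q₅-two-centres = from-yes (all-vertices? {5} λ c₁ → all-vertices? λ c₂ → farIsConnectedDominating? c₁ c₂)

module _ {A : Set} (mem : A → Vertex n → Set) where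

  Removed : List A → Pred (Vertex n) 0ℓ
  Removed F v = Any (λ s → mem s v) F

  within-two-balls-connected :
    {F : List A} {c₁ c₂ : Vertex n} → FarIsConnectedDominating c₁ c₂ →
    (∀ {v} → Removed F v → hamming c₁ v ≤ 1 ⊎ hamming c₂ v ≤ 1) →
    Removed F c₁ → Removed F c₂ → ¬ Disconnects mem F
  within-two-balls-connected {F} {c₁} {c₂} (root , dominates) within c₁-removed c₂-removed
                             (x , y , sx , sy , ¬x↝y) =
    ¬x↝y (dominated-connected far-survives (proj₂ root) dominates′ sx sy)
    where
    far-survives : ∀ {v} → Far c₁ c₂ v → ¬ Removed F v
    far-survives (far₁ , far₂) removed = [ <⇒≱ far₁ , <⇒≱ far₂ ] (within removed)

    dominates′ : Dominates (Far c₁ c₂) (¬_ ∘ Removed F)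
    dominates′ v sv = dominates v ((λ { refl → sv c₁-removed }) , (λ { refl → sv c₂-removed }))

  nothing-disconnects : ¬ Disconnects mem []
  nothing-disconnects (x , y , _ , _ , ¬x↝y) = ¬x↝y (hypercube-connected (λ _ ()) x y)

record Centred {A : Set} (mem : A → Vertex n → Set) : Set where
  field
    centre      : A → Vertex n
    centre-mem  : ∀ s → mem s (centre s)
    near-centre : ∀ {s v} → mem s v → hamming (centre s) v ≤ 1

star-within-ball : (s : Star n r) {v : Vertex n} → InStar s v → hamming (center s) v ≤ 1
star-within-ball s (inj₁ refl)     = subst (_≤ 1) (sym (hamming-refl (center s))) z≤n
star-within-ball s (inj₂ v∈leaves) =
  subst (λ w → hamming (center s) w ≤ 1) (sym (lookup-index v∈leaves))
        (≤-reflexive (hamming-adjacent {u = center s} {leaf} (adjacent s (index v∈leaves))))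
  where leaf = lookup (leaves s) (index v∈leaves)

stars-centred : Centred (InStar {n} {r})
stars-centred = record
  { centre      = center
  ; centre-mem  = λ _ → inj₁ refl
  ; near-centre = λ {s} → star-within-ball s
  }

substars-centred : {k : ℕ} → Centred (InSubStar {n} {k})
substars-centred = record
  { centre      = λ { (_ , _ , s) → center s }
  ; centre-mem  = λ _ → inj₁ refl
  ; near-centre = λ { {_ , _ , s} → star-within-ball s }
  }

module _ {A : Set} {mem : A → Vertex n → Set} (C : Centred mem) where
  open Centred C

  private
    variable
      s t : A

  one-member-connected : FarIsConnectedDominating (centre s) (centre s) → ¬ Disconnects mem (s ∷ [])
  one-member-connected {s} good =
    within-two-balls-connected mem good
      (λ { (here m) → inj₁ (near-centre m) ; (there ()) })
      (here (centre-mem s)) (here (centre-mem s))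

  two-members-connected : FarIsConnectedDominating (centre s) (centre t) → ¬ Disconnects mem (s ∷ t ∷ [])
  two-members-connected {s} {t} good =
    within-two-balls-connected mem good
      (λ { (here m) → inj₁ (near-centre m) ; (there (here m)) → inj₂ (near-centre m) ; (there (there ())) })
      (here (centre-mem s)) (there (here (centre-mem t)))

  fewer-than-two-connected :
    (∀ c → FarIsConnectedDominating c c) → ∀ F → length F < 2 → ¬ Disconnects mem F
  fewer-than-two-connected _    []          _              = nothing-disconnects mem
  fewer-than-two-connected good (s ∷ [])    _              = one-member-connected (good (centre s))
  fewer-than-two-connected _    (_ ∷ _ ∷ _) (s≤s (s≤s ()))

  fewer-than-three-connected :
    (∀ c₁ c₂ → FarIsConnectedDominating c₁ c₂) → ∀ F → length F < 3 → ¬ Disconnects mem F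
  fewer-than-three-connected _    []              _ = nothing-disconnects mem
  fewer-than-three-connected good (s ∷ [])        _ = one-member-connected (good (centre s) (centre s))
  fewer-than-three-connected good (s ∷ t ∷ [])    _ = two-members-connected (good (centre s) (centre t))
  fewer-than-three-connected _    (_ ∷ _ ∷ _ ∷ _) (s≤s (s≤s (s≤s ())))

isolated⇒disconnects :
  {A : Set} {mem : A → Vertex n → Set} {F : List A} {x y : Vertex n} → x ≢ y →
  ¬ Removed mem F x → ¬ Removed mem F y → (∀ i → Removed mem F (flip i x)) → Disconnects mem F
isolated⇒disconnects {x = x} {y} x≢y sx sy neighbours-removed = x , y , sx , sy , isolated
  where
  isolated : ¬ Reach _ x y
  isolated here = x≢y refl
  isolated (step {y = w} adj sw _) with adjacent⇒flip {u = x} {w} adj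
  ... | i , refl = sw (neighbours-removed i)

star : (c : Vertex n) (f : Fin r → Fin n) → Injective _≡_ _≡_ f → Star n r
star c f f-injective = record
  { center   = c
  ; leaves   = tabulate (λ i → flip (f i) c)
  ; adjacent = λ i → subst (Adj c) (sym (lookup∘tabulate _ i)) (flip-adjacent (f i) c)
  ; distinct = λ i j eq → f-injective (flip-injective c
      (trans (sym (lookup∘tabulate _ i)) (trans eq (lookup∘tabulate _ j))))
  }

inStar? : (s : Star n r) → Decidable (InStar s)
inStar? s v = v ≟ center s ⊎-dec v ∈? leaves s
  where open import Data.Vec.Membership.DecPropositional _≟_ using (_∈?_)

removed? : (F : List (Star n r)) → Decidable (Removed InStar F)
removed? F v = anyₗ? (λ s → inStar? s v) F

asSubStar : Star n r → SubStar n r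
asSubStar s = _ , ≤-refl , s

substars-disconnect : {F : List (Star n r)} → Disconnects InStar F → Disconnects InSubStar (map asSubStar F)
substars-disconnect (x , y , sx , sy , ¬x↝y) =
  x , y , sx ∘ map⁻ , sy ∘ map⁻ , ¬x↝y ∘ Reach-mono (_∘ map⁺)

Q₄-stars : List (Star 4 4)
Q₄-stars = star (true ∷ true ∷ false ∷ false ∷ []) id id
         ∷ star (false ∷ false ∷ true ∷ true ∷ []) id id
         ∷ []

Q₅-stars : List (Star 5 4)
Q₅-stars = star (true ∷ true ∷ false ∷ false ∷ false ∷ []) inject₁ inject₁-injective
         ∷ star (false ∷ false ∷ true ∷ true ∷ false ∷ []) inject₁ inject₁-injective
         ∷ star (true ∷ false ∷ false ∷ false ∷ true ∷ []) inject₁ inject₁-injective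
         ∷ []

Q₄-cut : Disconnects InStar Q₄-stars
Q₄-cut = isolated⇒disconnects (λ ())
  (from-no (removed? Q₄-stars (replicate 4 false)))
  (from-no (removed? Q₄-stars (replicate 4 true)))
  (from-yes (all? λ i → removed? Q₄-stars (flip i (replicate 4 false))))

Q₅-cut : Disconnects InStar Q₅-stars
Q₅-cut = isolated⇒disconnects (λ ())
  (from-no (removed? Q₅-stars (replicate 5 false)))
  (from-no (removed? Q₅-stars (replicate 5 true)))
  (from-yes (all? λ i → removed? Q₅-stars (flip i (replicate 5 false))))

κ-from-cut :
  (F : List (Star n r)) → Disconnects InStar F →
  (∀ {A} {mem : A → Vertex n → Set} → Centred mem → ∀ G → length G < length F → ¬ Disconnects mem G) →
  KappaStar n r (length F) × KappaSStar n r (length F)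
κ-from-cut F cut fewer-connected =
  ((F , refl , cut) , fewer-connected stars-centred) ,
  ((map asSubStar F , length-map asSubStar F , substars-disconnect cut) , fewer-connected substars-centred)

theorem4p3 : (n : ℕ) → 4 ≤ n → n ≤ 5 → KappaStar n 4 ⌈ n /2⌉ × KappaSStar n 4 ⌈ n /2⌉
theorem4p3 4 _ _ = κ-from-cut Q₄-stars Q₄-cut λ C → fewer-than-two-connected C Q₄-single-centre
theorem4p3 5 _ _ = κ-from-cut Q₅-stars Q₅-cut λ C → fewer-than-three-connected C Q₅-two-centres
theorem4p3 (suc (suc (suc (suc (suc (suc _)))))) _ (s≤s (s≤s (s≤s (s≤s (s≤s ())))))
theorem4p3 0 () _
theorem4p3 1 (s≤s ()) _
theorem4p3 2 (s≤s (s≤s ())) _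
theorem4p3 3 (s≤s (s≤s (s≤s ()))) _
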